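{- If $f$ is a first kind semi-arithmetic IASI of a graph $G$, then no edge of $G$ has a prime set-indexing number; that is, $|f^{+}(e)|$ is not prime for any edge $e$ of $G$.
   Context: All graphs are simple, finite, without isolated vertices; all sets are finite subsets of the non-negative integers $\mathbb{N}_0$. For $A,B\subseteq\mathbb{N}_0$, $A+B=\{a+b: a\in A, b\in B\}$. An integer additive set-indexer (IASI) of $G$ is an injective function $f:V(G)\to 2^{\mathbb{N}_0}$ such that $f^{+}(uv)=f(u)+f(v)$ defines an injective map on $E(G)$. The set-indexing number of a vertex or edge is the cardinality of its set-label. An AP-set is a set whose elements are in arithmetic progression, required to have at least three elements; its common difference is the deterministic index of the element it labels. An IASI is vertex-arithmetic if every vertex label is an AP-set. A first kind semi-arithmetic IASI is a vertex-arithmetic IASI $f$ such that for adjacent vertices $v_i,v_j$ with deterministic indices $d_i,d_j$, $d_j=k d_i$ for a non-negative integer $k>|f(v_i)|$. -}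

module Defs where

open import Data.Nat using (ℕ; _+_; _*_; _≤_; _<_)
open import Data.Nat.Properties using (_≟_)
open import Data.Fin using (Fin)
open import Data.List using (List; map; concatMap; upTo; length; deduplicate)
open import Data.List.Membership.Propositional using (_∈_)
open import Data.Product using (Σ; ∃; _×_)
open import Data.Sum using (_⊎_)
open import Relation.Nullary using (¬_)
open import Relation.Binary.PropositionalEquality using (_≡_)
open import Function.Bundles using (_⇔_)

-- Finite subsets of ℕ₀ are represented by lists (duplicates and order
-- irrelevant); sets are compared extensionally via membership.
FinSet : Set
FinSet = List ℕ

_≐_ : FinSet → FinSet → Set
A ≐ B = ∀ x → (x ∈ A) ⇔ (x ∈ B)

_⊕_ : FinSet → FinSet → FinSet
A ⊕ B = concatMap (λ a → map (a +_) B) A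

∣_∣ : FinSet → ℕ
∣ A ∣ = length (deduplicate _≟_ A)

IsAP : FinSet → ℕ → Set
IsAP A d = (1 ≤ d) × Σ ℕ (λ a → Σ ℕ (λ k → (3 ≤ k) × (A ≐ map (λ i → a + i * d) (upTo k))))

record Graph (n : ℕ) : Set₁ where
  field
    Adj       : Fin n → Fin n → Set
    sym       : ∀ {u v} → Adj u v → Adj v u
    irrefl    : ∀ {u} → ¬ Adj u u
    noIsolated : ∀ u → ∃ (λ v → Adj u v)

open Graph public

IsIASI : ∀ {n} → Graph n → (Fin n → FinSet) → Set
IsIASI {n} G f =
  (∀ u v → f u ≐ f v → u ≡ v) ×
  (∀ u v u′ v′ → Adj G u v → Adj G u′ v′ →
     (f u ⊕ f v) ≐ (f u′ ⊕ f v′) →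
     (u ≡ u′ × v ≡ v′) ⊎ (u ≡ v′ × v ≡ u′))

IsVertexArithmetic : ∀ {n} → Graph n → (Fin n → FinSet) → (Fin n → ℕ) → Set
IsVertexArithmetic G f d = IsIASI G f × (∀ v → IsAP (f v) (d v))

IsFirstKindSemiArithmetic : ∀ {n} → Graph n → (Fin n → FinSet) → Set
IsFirstKindSemiArithmetic {n} G f =
  Σ (Fin n → ℕ) λ d → IsVertexArithmetic G f d ×
    (∀ u v → Adj G u v → Σ ℕ λ k →
       (d v ≡ k * d u × ∣ f u ∣ < k) ⊎ (d u ≡ k * d v × ∣ f v ∣ < k))

-- If A and B are APs with m and m′ terms and common differences d and k d, then
-- A + B = { a + b + (i + j k) d : i < m, j < m′ }.  When m ≤ k the index i + j k is
-- a base-k expansion, so these m m′ values are pairwise distinct and |A + B| = m m′.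
-- Since an AP-set has at least three elements, m m′ is a product of two factors
-- exceeding one, hence not prime.
module Submission where

open import Defs hiding (sym)
open import Data.Nat using (ℕ; suc; _+_; _*_; _≤_; _<_; s≤s; z≤n; NonZero; >-nonZero)
open import Data.Nat.Properties
  using (_≟_; +-comm; +-cancelˡ-≡; *-cancelʳ-≡; *-identityʳ; *-monoʳ-<; <⇒≢; <⇒≤; ≤-<-trans; <-≤-trans)
open import Data.Nat.DivMod using (_%_; m<n⇒m%n≡m; [m+kn]%n≡m%n)
open import Data.Nat.Divisibility using (m∣m*n)
open import Data.Nat.Primality using (Prime; composite-≢; composite⇒¬prime)
open import Data.Nat.Solver using (module +-*-Solver)
open import Data.Fin using (Fin; toℕ; fromℕ<)
open import Data.Fin.Properties using (toℕ-injective; toℕ<n; toℕ-fromℕ<)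
open import Data.List using (List; []; _∷_; map; upTo; length; deduplicate; cartesianProductWith; allFin; _++_)
open import Data.List.Properties using (length-map; length-upTo; length-++; length-tabulate)
open import Data.List.Membership.Propositional using (_∈_)
open import Data.List.Membership.Propositional.Properties
  using (∈-cartesianProductWith⁺; ∈-cartesianProductWith⁻; ∈-map⁺; ∈-map⁻; ∈-upTo⁺; ∈-upTo⁻; ∈-allFin; deduplicate-∈⇔)
open import Data.List.Membership.Propositional.Properties.WithK using (unique∧set⇒bag)
open import Data.List.Relation.Unary.Unique.Propositional using (Unique)
open import Data.List.Relation.Unary.Unique.Propositional.Properties using (map⁺; upTo⁺; allFin⁺; cartesianProductWith⁺)
open import Data.List.Relation.Unary.Unique.DecPropositional.Properties _≟_ using (deduplicate-!)
open import Data.List.Relation.Binary.BagAndSetEquality using (∼bag⇒↭)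
open import Data.List.Relation.Binary.Permutation.Propositional.Properties using (↭-length)
open import Data.Product using (∃; ∃₂; _×_; _,_)
open import Data.Sum using (inj₁; inj₂)
open import Function using (_∘_; id)
open import Function.Bundles using (mk⇔; Equivalence)
open import Relation.Nullary using (¬_)
open import Relation.Binary.PropositionalEquality
  using (_≡_; _≢_; refl; sym; trans; cong; cong₂; subst; module ≡-Reasoning)

≐-refl : ∀ {A} → A ≐ A
≐-refl x = mk⇔ id id

≐-sym : ∀ {A B} → A ≐ B → B ≐ A
≐-sym A≐B x = mk⇔ (Equivalence.from (A≐B x)) (Equivalence.to (A≐B x))

≐-trans : ∀ {A B C} → A ≐ B → B ≐ C → A ≐ C
≐-trans A≐B B≐C x = mk⇔ (Equivalence.to (B≐C x) ∘ Equivalence.to (A≐B x))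
                        (Equivalence.from (A≐B x) ∘ Equivalence.from (B≐C x))

deduplicate-≐ : ∀ A → A ≐ deduplicate _≟_ A
deduplicate-≐ A x = deduplicate-∈⇔ _≟_

∣∣≡length : ∀ {A L} → Unique L → A ≐ L → ∣ A ∣ ≡ length L
∣∣≡length {A} L! A≐L = ↭-length (∼bag⇒↭ (unique∧set⇒bag (deduplicate-! A) L!
  (λ {x} → ≐-trans (≐-sym (deduplicate-≐ A)) A≐L x)))

∣∣-resp-≐ : ∀ {A B} → A ≐ B → ∣ A ∣ ≡ ∣ B ∣
∣∣-resp-≐ {B = B} A≐B = ∣∣≡length (deduplicate-! B) (≐-trans A≐B (deduplicate-≐ B))

⊕≡cartesianProductWith : ∀ A B → A ⊕ B ≡ cartesianProductWith _+_ A B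
⊕≡cartesianProductWith []      B = refl
⊕≡cartesianProductWith (x ∷ A) B = cong (map (x +_) B ++_) (⊕≡cartesianProductWith A B)

∈-⊕⁻ : ∀ A B {x} → x ∈ A ⊕ B → ∃₂ λ a b → a ∈ A × b ∈ B × x ≡ a + b
∈-⊕⁻ A B x∈ rewrite ⊕≡cartesianProductWith A B = ∈-cartesianProductWith⁻ _+_ A B x∈

∈-⊕⁺ : ∀ A B {a b} → a ∈ A → b ∈ B → a + b ∈ A ⊕ B
∈-⊕⁺ A B a∈ b∈ rewrite ⊕≡cartesianProductWith A B = ∈-cartesianProductWith⁺ _+_ a∈ b∈

⊕-resp-≐ : ∀ {A A′ B B′} → A ≐ A′ → B ≐ B′ → (A ⊕ B) ≐ (A′ ⊕ B′)
⊕-resp-≐ A≐A′ B≐B′ x = mk⇔ (transport A≐A′ B≐B′) (transport (≐-sym A≐A′) (≐-sym B≐B′))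
  where
  transport : ∀ {C C′ D D′} → C ≐ C′ → D ≐ D′ → x ∈ C ⊕ D → x ∈ C′ ⊕ D′
  transport {C} {C′} {D} {D′} C≐C′ D≐D′ x∈ with c , e , c∈ , e∈ , refl ← ∈-⊕⁻ C D x∈ =
    ∈-⊕⁺ C′ D′ (Equivalence.to (C≐C′ c) c∈) (Equivalence.to (D≐D′ e) e∈)

⊕-comm : ∀ A B → (A ⊕ B) ≐ (B ⊕ A)
⊕-comm A B x = mk⇔ (swap A B) (swap B A)
  where
  swap : ∀ C D → x ∈ C ⊕ D → x ∈ D ⊕ C
  swap C D x∈ with c , e , c∈ , e∈ , refl ← ∈-⊕⁻ C D x∈ =
    subst (_∈ D ⊕ C) (+-comm e c) (∈-⊕⁺ D C e∈ c∈)

length-cartesianProductWith : ∀ {A B C : Set} (g : A → B → C) xs ys →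
  length (cartesianProductWith g xs ys) ≡ length xs * length ys
length-cartesianProductWith g []       ys = refl
length-cartesianProductWith g (x ∷ xs) ys =
  trans (length-++ (map (g x) ys)) (cong₂ _+_ (length-map (g x) ys) (length-cartesianProductWith g xs ys))

+-*-injective : ∀ {k i j i′ j′} → i < k → i′ < k → i + j * k ≡ i′ + j′ * k → i ≡ i′ × j ≡ j′
+-*-injective {k} {i} {j} {i′} {j′} i<k i′<k e = i≡i′ , *-cancelʳ-≡ j j′ k (+-cancelˡ-≡ i _ _ e′)
  where
  instance
    k≢0 : NonZero k
    k≢0 = >-nonZero (≤-<-trans z≤n i<k)
  open ≡-Reasoning
  i≡i′ : i ≡ i′
  i≡i′ = begin
    i                 ≡⟨ m<n⇒m%n≡m i<k ⟨
    i % k             ≡⟨ [m+kn]%n≡m%n i j k ⟨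
    (i + j * k) % k   ≡⟨ cong (_% k) e ⟩
    (i′ + j′ * k) % k ≡⟨ [m+kn]%n≡m%n i′ j′ k ⟩
    i′ % k            ≡⟨ m<n⇒m%n≡m i′<k ⟩
    i′                ∎
  e′ : i + j * k ≡ i + j′ * k
  e′ = subst (λ t → i + j * k ≡ t + j′ * k) (sym i≡i′) e

AP : ℕ → ℕ → ℕ → FinSet
AP a d m = map (λ i → a + i * d) (upTo m)

AP-unique : ∀ a {d} m → 1 ≤ d → Unique (AP a d m)
AP-unique a {suc d} m _ = map⁺ (λ {i} {j} e → *-cancelʳ-≡ i j (suc d) (+-cancelˡ-≡ a _ _ e)) (upTo⁺ m)

∣AP∣≡m : ∀ a {d} m → 1 ≤ d → ∣ AP a d m ∣ ≡ m
∣AP∣≡m a m 1≤d = trans (∣∣≡length (AP-unique a m 1≤d) ≐-refl)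
                       (trans (length-map _ (upTo m)) (length-upTo m))

∈-AP⁻ : ∀ {a d m x} → x ∈ AP a d m → ∃ λ (i : Fin m) → x ≡ a + toℕ i * d
∈-AP⁻ {a} {d} x∈ with i , i∈ , refl ← ∈-map⁻ _ x∈ =
  fromℕ< (∈-upTo⁻ i∈) , cong (λ j → a + j * d) (sym (toℕ-fromℕ< (∈-upTo⁻ i∈)))

∈-AP⁺ : ∀ a d {m} (i : Fin m) → a + toℕ i * d ∈ AP a d m
∈-AP⁺ a d i = ∈-map⁺ (λ j → a + j * d) (∈-upTo⁺ (toℕ<n i))

module _ (a b : ℕ) {d k : ℕ} (m m′ : ℕ) where

  sumsetElement : Fin m → Fin m′ → ℕ
  sumsetElement i j = (a + b) + (toℕ i + toℕ j * k) * d

  sumsetElement-injective : 1 ≤ d → m ≤ k →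
    ∀ {i i′ j j′} → sumsetElement i j ≡ sumsetElement i′ j′ → i ≡ i′ × j ≡ j′
  sumsetElement-injective 1≤d m≤k {i} {i′} e
    with i≡i′ , j≡j′ ← +-*-injective (<-≤-trans (toℕ<n i) m≤k) (<-≤-trans (toℕ<n i′) m≤k)
                         (*-cancelʳ-≡ _ _ d {{>-nonZero 1≤d}} (+-cancelˡ-≡ (a + b) _ _ e))
    = toℕ-injective i≡i′ , toℕ-injective j≡j′

  sumsetElements : List ℕ
  sumsetElements = cartesianProductWith sumsetElement (allFin m) (allFin m′)

  AP⊕AP≐ : (AP a d m ⊕ AP b (k * d) m′) ≐ sumsetElements
  AP⊕AP≐ x = mk⇔ to from
    where
    open +-*-Solver
    regroup : ∀ i j → (a + i * d) + (b + j * (k * d)) ≡ (a + b) + (i + j * k) * d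
    regroup i j = solve 6 (λ a b d k i j → (a :+ i :* d) :+ (b :+ j :* (k :* d)) := (a :+ b) :+ (i :+ j :* k) :* d)
                          refl a b d k i j
    to : x ∈ AP a d m ⊕ AP b (k * d) m′ → x ∈ sumsetElements
    to x∈ with _ , _ , a′∈ , b′∈ , refl ← ∈-⊕⁻ (AP a d m) (AP b (k * d) m′) x∈
      with i , refl ← ∈-AP⁻ a′∈
      with j , refl ← ∈-AP⁻ b′∈ =
      subst (_∈ sumsetElements) (sym (regroup (toℕ i) (toℕ j)))
            (∈-cartesianProductWith⁺ sumsetElement (∈-allFin i) (∈-allFin j))
    from : x ∈ sumsetElements → x ∈ AP a d m ⊕ AP b (k * d) m′
    from x∈ with i , j , _ , _ , refl ← ∈-cartesianProductWith⁻ sumsetElement (allFin m) (allFin m′) x∈ =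
      subst (_∈ AP a d m ⊕ AP b (k * d) m′) (regroup (toℕ i) (toℕ j))
            (∈-⊕⁺ (AP a d m) (AP b (k * d) m′) (∈-AP⁺ a d i) (∈-AP⁺ b (k * d) j))

  ∣AP⊕AP∣≡m*m′ : 1 ≤ d → m ≤ k → ∣ AP a d m ⊕ AP b (k * d) m′ ∣ ≡ m * m′
  ∣AP⊕AP∣≡m*m′ 1≤d m≤k = begin
    ∣ AP a d m ⊕ AP b (k * d) m′ ∣
      ≡⟨ ∣∣≡length unique AP⊕AP≐ ⟩
    length sumsetElements
      ≡⟨ length-cartesianProductWith sumsetElement (allFin m) (allFin m′) ⟩
    length (allFin m) * length (allFin m′)
      ≡⟨ cong₂ _*_ (length-tabulate {n = m} id) (length-tabulate {n = m′} id) ⟩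
    m * m′
      ∎
    where
    open ≡-Reasoning
    unique : Unique sumsetElements
    unique = cartesianProductWith⁺ sumsetElement (sumsetElement-injective 1≤d m≤k) (allFin⁺ m) (allFin⁺ m′)

¬prime-* : ∀ {m n} → 2 ≤ m → 2 ≤ n → ¬ Prime (m * n)
¬prime-* {m@(suc (suc _))} {n@(suc (suc _))} (s≤s (s≤s _)) 2≤n@(s≤s (s≤s _)) =
  composite⇒¬prime (composite-≢ m m≢m*n (m∣m*n n))
  where
  m≢m*n : m ≢ m * n
  m≢m*n m≡m*n = <⇒≢ (*-monoʳ-< m 2≤n) (trans (*-identityʳ m) m≡m*n)

sumset-of-APs-¬prime : ∀ {A B d k} → IsAP A d → IsAP B (k * d) → ∣ A ∣ < k → ¬ Prime ∣ A ⊕ B ∣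
sumset-of-APs-¬prime {A} {B} {d} {k} (1≤d , a , m , 3≤m , A≐) (_ , b , m′ , 3≤m′ , B≐) ∣A∣<k =
  subst (¬_ ∘ Prime) (sym ∣A⊕B∣≡m*m′) (¬prime-* (<⇒≤ 3≤m) (<⇒≤ 3≤m′))
  where
  m≤k : m ≤ k
  m≤k = <⇒≤ (subst (_< k) (trans (∣∣-resp-≐ A≐) (∣AP∣≡m a m 1≤d)) ∣A∣<k)
  ∣A⊕B∣≡m*m′ : ∣ A ⊕ B ∣ ≡ m * m′
  ∣A⊕B∣≡m*m′ = trans (∣∣-resp-≐ (⊕-resp-≐ A≐ B≐)) (∣AP⊕AP∣≡m*m′ a b m m′ 1≤d m≤k)

mainTheorem3 : ∀ {n} (G : Graph n) (f : Fin n → FinSet) →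
    IsFirstKindSemiArithmetic G f →
    ∀ u v → Adj G u v → ¬ Prime ∣ f u ⊕ f v ∣
mainTheorem3 G f (d , (_ , isAP) , indices) u v uv with indices u v uv
... | k , inj₁ (dv≡k*du , ∣fu∣<k) =
  sumset-of-APs-¬prime (isAP u) (subst (IsAP (f v)) dv≡k*du (isAP v)) ∣fu∣<k
... | k , inj₂ (du≡k*dv , ∣fv∣<k) =
  sumset-of-APs-¬prime (isAP v) (subst (IsAP (f u)) du≡k*dv (isAP u)) ∣fv∣<k
  ∘ subst Prime (∣∣-resp-≐ (⊕-comm (f u) (f v)))
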